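{- Let $D$ be a strongly connected balanced bipartite digraph of order $2a$, where $a\geq 2$, such that $d(u)+d(v)\geq 3a+1$ for every dominating pair $\{u,v\}$ of vertices of $D$. Then $D$ contains a cycle factor.
   Context: Digraphs have no loops and no multiple arcs. For a vertex $v$, $d(v)=d^+(v)+d^-(v)$ (out-degree plus in-degree). A pair of distinct vertices $\{u,v\}$ is dominating if there is a vertex $w$ with $uw$ and $vw$ both arcs of $D$. Balanced bipartite: two partite sets of equal size $a$. A cycle factor is a collection of pairwise vertex-disjoint directed cycles of $D$ whose vertex sets together cover $V(D)$. -}

module Defs where

open import Data.Nat using (ℕ; zero; suc; _+_)
open import Data.Bool using (Bool; true; false)
open import Data.Fin using (Fin; zero; suc)
open import Data.List using (List; []; _∷_; concat)
open import Data.List.Relation.Unary.All using (All)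
open import Data.List.Relation.Unary.Unique.Propositional using (Unique)
open import Data.List.Membership.Propositional using (_∈_)
open import Data.Product using (_×_; ∃)
open import Data.Empty using (⊥)
open import Relation.Binary.PropositionalEquality using (_≡_; _≢_)

record Digraph (n : ℕ) : Set where
  field
    adj      : Fin n → Fin n → Bool
    loopless : ∀ v → adj v v ≡ false

open Digraph public

Arc : ∀ {n} → Digraph n → Fin n → Fin n → Set
Arc D u v = adj D u v ≡ true

count : ∀ {n} → (Fin n → Bool) → ℕ
count {zero}  f = 0
count {suc n} f with f zero
... | true  = suc (count (λ i → f (suc i)))
... | false = count (λ i → f (suc i))

outdeg : ∀ {n} → Digraph n → Fin n → ℕ
outdeg D v = count (λ w → adj D v w)

indeg : ∀ {n} → Digraph n → Fin n → ℕ
indeg D v = count (λ w → adj D w v)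

deg : ∀ {n} → Digraph n → Fin n → ℕ
deg D v = outdeg D v + indeg D v

data Reach {n} (D : Digraph n) (u : Fin n) : Fin n → Set where
  here : Reach D u u
  step : ∀ {v w} → Reach D u v → Arc D v w → Reach D u w

StronglyConnected : ∀ {n} → Digraph n → Set
StronglyConnected D = ∀ u v → Reach D u v

BalancedBipartite : (a : ℕ) → Digraph (a + a) → Set
BalancedBipartite a D =
  ∃ λ (part : Fin (a + a) → Bool) →
    count part ≡ a × (∀ u v → Arc D u v → part u ≢ part v)

Dominating : ∀ {n} → Digraph n → Fin n → Fin n → Set
Dominating D u v = u ≢ v × ∃ λ w → Arc D u w × Arc D v w

-- arcs cur → y₁ → … → y_k → first
ArcsAlong : ∀ {n} → Digraph n → Fin n → Fin n → List (Fin n) → Set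
ArcsAlong D f cur []       = Arc D cur f
ArcsAlong D f cur (y ∷ ys) = Arc D cur y × ArcsAlong D f y ys

-- a directed cycle x₀ → x₁ → … → x_k → x₀ given as its vertex list
-- (k ≥ 1; distinctness of vertices is enforced in CycleFactor)
IsCycle : ∀ {n} → Digraph n → List (Fin n) → Set
IsCycle D []           = ⊥
IsCycle D (x ∷ [])     = ⊥
IsCycle D (x ∷ y ∷ ys) = ArcsAlong D x x (y ∷ ys)

CycleFactor : ∀ {n} → Digraph n → Set
CycleFactor {n} D =
  ∃ λ (cs : List (List (Fin n))) →
    All (IsCycle D) cs × Unique (concat cs) × (∀ v → v ∈ concat cs)

module Submission where

-- Let L and Y be the two sides. A cycle factor is the same as a permutation σ of the
-- vertices with an arc v → σ v for every v, and σ is assembled from a matching of L into Y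
-- along arcs and one of Y into L. By Hall's theorem the first exists unless some S ⊆ L has
-- fewer out-neighbours than elements; take such an S minimal. Minimality makes every
-- out-neighbour of S shared by two vertices of S, so the degree condition applies inside S
-- and forces |N⁺(S)| to be large. The vertices T of Y outside N⁺(S) have all their
-- in-neighbours in L ∖ S, so their degrees are small: no two of them have a common
-- out-neighbour, and choosing one out-neighbour for each vertex of T is injective. It cannot
-- land in L ∖ S, which is smaller than T, so some y ∈ T points into S; that vertex of S has a
-- second in-neighbour z, and the dominating pair {y, z} has degree sum below 3a + 1.
-- Strong connectivity is only used to give every vertex an out-neighbour.

open import Defs
open import Data.Nat using (ℕ; zero; suc; _+_; _*_; _≤_; _<_; _∸_; z≤n; s≤s; _≤?_; _<?_)
open import Data.Nat.Properties
open import Data.Nat.Tactic.RingSolver using (solve-∀)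
open import Data.Bool using (Bool; true; false; not; _∧_; _∨_; _xor_; if_then_else_)
open import Data.Bool.Properties
  using (∧-conicalˡ; ∧-conicalʳ; ∨-zeroʳ; ∨-identityʳ; ∧-zeroʳ; not-involutive; xor-inverseˡ; xor-inverseʳ; ¬-not)
open import Data.Fin using (Fin; zero; suc; toℕ) renaming (_≟_ to _≟ᶠ_)
open import Data.Product using (_×_; _,_; ∃; proj₁; proj₂)
open import Data.Sum using (_⊎_; inj₁; inj₂; [_,_]′)
open import Data.Empty using (⊥; ⊥-elim)
open import Relation.Binary.PropositionalEquality
open import Relation.Binary using (tri<; tri≈; tri>)
open import Relation.Nullary using (¬_; Dec; yes; no)
open import Relation.Nullary.Decidable using (⌊_⌋; _×-dec_)
open import Data.Vec using (Vec; lookup; tabulate)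
open import Data.Vec.Properties using (lookup∘tabulate)
open import Data.Fin.Subset.Properties using (anySubset?)
open import Function using (_∘_)
open import Data.Fin.Properties using (pigeonhole; toℕ-injective; any?)
open import Data.Bool.Properties using () renaming (_≟_ to _≟ᵇ_)
open import Data.List using (List; []; _∷_; map; concat; filter; allFin)
open import Data.List.Membership.Propositional using (_∈_)
open import Data.List.Membership.Propositional.Properties
  using (∈-map⁺; ∈-map⁻; ∈-concat⁺′; ∈-concat⁻′; ∈-filter⁺; ∈-allFin)
open import Data.List.Relation.Unary.Any using (here; there)
open import Data.List.Relation.Unary.All as All using (All; []; _∷_; all?)
open import Data.List.Relation.Unary.Unique.Propositional using (Unique)
open import Data.List.Relation.Unary.AllPairs using ([]; _∷_)
import Data.List.Relation.Unary.Unique.Propositional.Properties as Unique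
import Data.List.Relation.Unary.All.Properties as AllP
open import Data.List.Extrema ≤-totalOrder using (argmin; f[argmin]≤f[xs]; argmin-sel)

-- Characteristic functions, the form `count` takes; the library's Vec-based subsets
-- appear only in `critical?`, to enumerate all subsets.
Subset : ℕ → Set
Subset n = Fin n → Bool

true≢false : ∀ {b} → b ≡ true → b ≡ false → ⊥
true≢false refl ()

not-true : ∀ {b} → b ≡ false → not b ≡ true
not-true refl = refl

not-false : ∀ {b} → not b ≡ true → b ≡ false
not-false {false} _ = refl

∧-intro : ∀ {a b} → a ≡ true → b ≡ true → a ∧ b ≡ true
∧-intro refl refl = refl

∧-not-intro : ∀ {a b} → a ≡ true → b ≡ false → a ∧ not b ≡ true
∧-not-intro refl refl = refl

∧-not-elim : ∀ {a b} → a ∧ not b ≡ true → b ≡ false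
∧-not-elim {true} = not-false

∧-not-false : ∀ {a b} → b ≡ true → a ∧ not b ≡ false
∧-not-false {a} refl = ∧-zeroʳ a

∨-elim : ∀ {a b} → a ∨ b ≡ true → a ≡ true ⊎ b ≡ true
∨-elim {true}  _ = inj₁ refl
∨-elim {false} p = inj₂ p

∨-unlessˡ : ∀ {a b} → (a ≡ false → b ≡ true) → a ∨ b ≡ true
∨-unlessˡ {true}  _ = refl
∨-unlessˡ {false} h = h refl

∨-unlessʳ : ∀ {a b} → (b ≡ false → a ≡ true) → a ∨ b ≡ true
∨-unlessʳ {a} {true}  _ = ∨-zeroʳ a
∨-unlessʳ {a} {false} h = trans (∨-identityʳ a) (h refl)

any : ∀ {m} → Subset m → Bool
any {zero}  S = false
any {suc m} S = S zero ∨ any (λ i → S (suc i))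

any-sound : ∀ {m} (S : Subset m) → any S ≡ true → ∃ λ i → S i ≡ true
any-sound {suc m} S p with S zero in e
... | true  = zero , e
... | false with any-sound (λ i → S (suc i)) p
... | i , q = suc i , q

any-complete : ∀ {m} (S : Subset m) i → S i ≡ true → any S ≡ true
any-complete {suc m} S zero p rewrite p = refl
any-complete {suc m} S (suc i) p with S zero
... | true  = refl
... | false = any-complete (λ j → S (suc j)) i p

any-cong : ∀ {m} {S T : Subset m} → (∀ i → S i ≡ T i) → any S ≡ any T
any-cong {zero}  e = refl
any-cong {suc m} e = cong₂ _∨_ (e zero) (any-cong (λ i → e (suc i)))

module _ {n : ℕ} where

  infix 4 _∈ₛ_ _⊆_
  infixl 6 _∩_ _─_ _∪_ _-_

  _∈ₛ_ : Fin n → Subset n → Set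
  i ∈ₛ S = S i ≡ true

  _⊆_ : Subset n → Subset n → Set
  S ⊆ T = ∀ i → i ∈ₛ S → i ∈ₛ T

  _∩_ _─_ _∪_ : Subset n → Subset n → Subset n
  (S ∩ T) i = S i ∧ T i
  (S ─ T) i = S i ∧ not (T i)
  (S ∪ T) i = S i ∨ T i

  ∁ : Subset n → Subset n
  ∁ S i = not (S i)

  ⁅_⁆ : Fin n → Subset n
  ⁅ x ⁆ i = ⌊ i ≟ᶠ x ⌋

  _-_ : Subset n → Fin n → Subset n
  S - x = S ─ ⁅ x ⁆

  x∈⁅x⁆ : ∀ x → x ∈ₛ ⁅ x ⁆
  x∈⁅x⁆ x with x ≟ᶠ x
  ... | yes _  = refl
  ... | no x≢x = ⊥-elim (x≢x refl)

  ∈⁅⁆⁻ : ∀ {x} i → i ∈ₛ ⁅ x ⁆ → i ≡ x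
  ∈⁅⁆⁻ {x} i p with i ≟ᶠ x
  ... | yes i≡x = i≡x

  ∉⁅⁆ : ∀ {x i} → i ≢ x → ⁅ x ⁆ i ≡ false
  ∉⁅⁆ {x} {i} i≢x with i ≟ᶠ x
  ... | yes i≡x = ⊥-elim (i≢x i≡x)
  ... | no _    = refl

  ⁅⁆⊆ : ∀ {S x} → x ∈ₛ S → ⁅ x ⁆ ⊆ S
  ⁅⁆⊆ x∈S i p rewrite ∈⁅⁆⁻ i p = x∈S

  ∈--⁻ : ∀ {S x} i → i ∈ₛ S - x → i ≢ x
  ∈--⁻ {x = x} i p refl = true≢false (x∈⁅x⁆ x) (∧-not-elim p)

  find : (S : Subset n) → (∃ λ i → i ∈ₛ S) ⊎ (∀ i → S i ≡ false)
  find S with any? (λ i → S i ≟ᵇ true)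
  ... | yes found = inj₁ found
  ... | no none   = inj₂ λ i → ¬-not λ i∈S → none (i , i∈S)

  ⊆? : (S T : Subset n) → Dec (S ⊆ T)
  ⊆? S T with find (S ─ T)
  ... | inj₁ (i , p) = no λ S⊆T → true≢false (S⊆T i (∧-conicalˡ _ _ p)) (∧-not-elim p)
  ... | inj₂ none    = yes λ i i∈S → inside i i∈S (none i)
    where
    inside : ∀ i → i ∈ₛ S → (S ─ T) i ≡ false → i ∈ₛ T
    inside i i∈S e with T i
    ... | true  = refl
    ... | false rewrite i∈S = ⊥-elim (true≢false refl e)

count-cong : ∀ {n} {S T : Subset n} → (∀ i → S i ≡ T i) → count S ≡ count T
count-cong {zero}  e = refl
count-cong {suc n} {S} {T} e with S zero | T zero | e zero
... | true  | true  | _ = cong suc (count-cong (λ i → e (suc i)))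
... | false | false | _ = count-cong (λ i → e (suc i))

count-mono : ∀ {n} {S T : Subset n} → S ⊆ T → count S ≤ count T
count-mono {zero} h = z≤n
count-mono {suc n} {S} {T} h with S zero in eS | T zero in eT
... | true  | true  = s≤s (count-mono (λ i → h (suc i)))
... | false | true  = m≤n⇒m≤1+n (count-mono (λ i → h (suc i)))
... | false | false = count-mono (λ i → h (suc i))
... | true  | false = ⊥-elim (true≢false (h zero eS) eT)

count-empty : ∀ {n} (S : Subset n) → (∀ i → S i ≡ false) → count S ≡ 0
count-empty {zero}  S h = refl
count-empty {suc n} S h with S zero | h zero
... | false | _ = count-empty (λ i → S (suc i)) (λ i → h (suc i))

count-full : ∀ {n} (S : Subset n) → (∀ i → i ∈ₛ S) → count S ≡ n
count-full {zero}  S h = refl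
count-full {suc n} S h with S zero | h zero
... | true | _ = cong suc (count-full (λ i → S (suc i)) (λ i → h (suc i)))

count-singleton : ∀ {n} (x : Fin n) → count ⁅ x ⁆ ≡ 1
count-singleton {suc n} zero    = cong suc (count-empty (λ i → ⁅ zero {n} ⁆ (suc i)) (λ i → refl))
count-singleton {suc n} (suc x) = trans (count-cong ⁅suc⁆) (count-singleton x)
  where
  ⁅suc⁆ : ∀ i → ⁅ suc x ⁆ (suc i) ≡ ⁅ x ⁆ i
  ⁅suc⁆ i = by-cases (i ≟ᶠ x)
    where
    by-cases : Dec (i ≡ x) → ⁅ suc x ⁆ (suc i) ≡ ⁅ x ⁆ i
    by-cases (yes refl) = trans (x∈⁅x⁆ (suc x)) (sym (x∈⁅x⁆ x))
    by-cases (no i≢x)   = trans (∉⁅⁆ λ { refl → i≢x refl }) (sym (∉⁅⁆ i≢x))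

count-split : ∀ {n} (S T : Subset n) → count S ≡ count (S ∩ T) + count (S ─ T)
count-split {zero}  S T = refl
count-split {suc n} S T with S zero | T zero
... | true  | true  = cong suc (count-split (λ i → S (suc i)) (λ i → T (suc i)))
... | true  | false = trans (cong suc (count-split (λ i → S (suc i)) (λ i → T (suc i)))) (sym (+-suc _ _))
... | false | true  = count-split (λ i → S (suc i)) (λ i → T (suc i))
... | false | false = count-split (λ i → S (suc i)) (λ i → T (suc i))

∩-⊆ : ∀ {n} {S T : Subset n} → T ⊆ S → ∀ i → (S ∩ T) i ≡ T i
∩-⊆ {S = S} {T} T⊆S i with T i in e
... | true  = trans (cong (_∧ true) (T⊆S i e)) refl
... | false = ∧-zeroʳ (S i)

count-⊆-split : ∀ {n} {S T : Subset n} → T ⊆ S → count T + count (S ─ T) ≡ count S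
count-⊆-split {S = S} {T} T⊆S =
  trans (cong (_+ count (S ─ T)) (sym (count-cong (∩-⊆ T⊆S)))) (sym (count-split S T))

count-remove : ∀ {n} (S : Subset n) x → x ∈ₛ S → count S ≡ suc (count (S - x))
count-remove S x x∈S = begin
  count S                      ≡⟨ sym (count-⊆-split (⁅⁆⊆ {S = S} x∈S)) ⟩
  count ⁅ x ⁆ + count (S - x)  ≡⟨ cong (_+ count (S - x)) (count-singleton x) ⟩
  suc (count (S - x))          ∎
  where open ≡-Reasoning

∈⇒count-pos : ∀ {n} (S : Subset n) i → i ∈ₛ S → 1 ≤ count S
∈⇒count-pos S i p rewrite count-remove S i p = s≤s z≤n

count-pos⇒∈ : ∀ {n} (S : Subset n) → 1 ≤ count S → ∃ λ i → i ∈ₛ S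
count-pos⇒∈ S pos with find S
... | inj₁ p    = p
... | inj₂ none = ⊥-elim (<⇒≢ pos (sym (count-empty S none)))

count-∪ : ∀ {n} (S T : Subset n) → count (S ∪ T) ≤ count S + count T
count-∪ {zero}  S T = z≤n
count-∪ {suc n} S T with S zero | T zero | count-∪ (S ∘ suc) (T ∘ suc)
... | true  | true  | ih = s≤s (≤-trans (m≤n⇒m≤1+n ih) (≤-reflexive (sym (+-suc _ _))))
... | true  | false | ih = s≤s ih
... | false | true  | ih = ≤-trans (s≤s ih) (≤-reflexive (sym (+-suc _ _)))
... | false | false | ih = ih

count-∪-disjoint : ∀ {n} (S T : Subset n) → (∀ i → i ∈ₛ S → T i ≡ false) →
                   count (S ∪ T) ≡ count S + count T
count-∪-disjoint {zero}  S T d = refl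
count-∪-disjoint {suc n} S T d with S zero in eS | T zero in eT | count-∪-disjoint (S ∘ suc) (T ∘ suc) (d ∘ suc)
... | true  | true  | _  = ⊥-elim (true≢false eT (d zero eS))
... | true  | false | ih = cong suc ih
... | false | true  | ih = trans (cong suc ih) (sym (+-suc _ _))
... | false | false | ih = ih

count-∁ : ∀ {n} (S : Subset n) → count S + count (∁ S) ≡ n
count-∁ S = trans (sym (count-split (λ _ → true) S)) (count-full _ (λ _ → refl))

count-injection : ∀ {n} {S T : Subset n} (g : Fin n → Fin n) →
  (∀ i → i ∈ₛ S → g i ∈ₛ T) →
  (∀ i j → i ∈ₛ S → j ∈ₛ S → g i ≡ g j → i ≡ j) →
  count S ≤ count T
count-injection {S = S} {T} g maps inj = go (count S) S T refl maps inj
  where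
  go : ∀ m S T → count S ≡ m → (∀ i → i ∈ₛ S → g i ∈ₛ T) →
       (∀ i j → i ∈ₛ S → j ∈ₛ S → g i ≡ g j → i ≡ j) → count S ≤ count T
  go m S T c maps inj with find S
  ... | inj₂ none = ≤-trans (≤-reflexive (count-empty S none)) z≤n
  go zero S T c maps inj | inj₁ (x , x∈S) = ⊥-elim (1+n≰n (≤-trans (∈⇒count-pos S x x∈S) (≤-reflexive c)))
  go (suc m) S T c maps inj | inj₁ (x , x∈S) rewrite count-remove S x x∈S | count-remove T (g x) (maps x x∈S) =
    s≤s (go m (S - x) (T - g x) (suc-injective c) maps′
            (λ i j p q → inj i j (∧-conicalˡ _ _ p) (∧-conicalˡ _ _ q)))
    where
    maps′ : ∀ i → i ∈ₛ S - x → g i ∈ₛ T - g x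
    maps′ i p = ∧-not-intro (maps i i∈S) (∉⁅⁆ λ gi≡gx → ∈--⁻ {S = S} i p (inj i x i∈S x∈S gi≡gx))
      where i∈S = ∧-conicalˡ _ _ p

module Hall {n : ℕ} (E : Fin n → Fin n → Bool) where

  N : Subset n → Subset n → Subset n
  N Y S w = Y w ∧ any (λ v → S v ∧ E v w)

  ∈-N : ∀ Y S {w} v → w ∈ₛ Y → v ∈ₛ S → E v w ≡ true → w ∈ₛ N Y S
  ∈-N Y S {w} v w∈Y v∈S e = ∧-intro w∈Y (any-complete (λ v → S v ∧ E v w) v (∧-intro v∈S e))

  ∈-N⁻ : ∀ Y S w → w ∈ₛ N Y S → w ∈ₛ Y × ∃ λ v → v ∈ₛ S × E v w ≡ true
  ∈-N⁻ Y S w p with any-sound (λ v → S v ∧ E v w) (∧-conicalʳ (Y w) _ p)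
  ... | v , q = ∧-conicalˡ (Y w) _ p , v , ∧-conicalˡ (S v) _ q , ∧-conicalʳ (S v) _ q

  N⊆ : ∀ Y S → N Y S ⊆ Y
  N⊆ Y S w p = proj₁ (∈-N⁻ Y S w p)

  N-cong : ∀ Y {S S′} → (∀ i → S i ≡ S′ i) → ∀ w → N Y S w ≡ N Y S′ w
  N-cong Y e w = cong (Y w ∧_) (any-cong (λ v → cong (_∧ E v w) (e v)))

  HallCondition : Subset n → Subset n → Set
  HallCondition L Y = ∀ S → S ⊆ L → count S ≤ count (N Y S)

  record Matching (L Y : Subset n) : Set where
    field
      match     : Fin n → Fin n
      arc       : ∀ v → v ∈ₛ L → E v (match v) ≡ true
      into      : ∀ v → v ∈ₛ L → match v ∈ₛ Y
      injective : ∀ u v → u ∈ₛ L → v ∈ₛ L → match u ≡ match v → u ≡ v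

  open Matching

  empty-matching : ∀ {L Y} → (∀ v → L v ≡ false) → Matching L Y
  empty-matching none = record
    { match = λ v → v
    ; arc = λ v p → ⊥-elim (true≢false p (none v))
    ; into = λ v p → ⊥-elim (true≢false p (none v))
    ; injective = λ u v p → ⊥-elim (true≢false p (none u))
    }

  singleton-matching : ∀ {x y} → E x y ≡ true → Matching ⁅ x ⁆ ⁅ y ⁆
  singleton-matching {x} {y} e = record
    { match = λ _ → y
    ; arc = λ v p → subst (λ z → E z y ≡ true) (sym (∈⁅⁆⁻ v p)) e
    ; into = λ _ _ → x∈⁅x⁆ y
    ; injective = λ u v p q _ → trans (∈⁅⁆⁻ u p) (sym (∈⁅⁆⁻ v q))
    }

  join : ∀ {L L₁ L₂ Y Y₁ Y₂} (P : Subset n) → Matching L₁ Y₁ → Matching L₂ Y₂ →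
         (∀ v → v ∈ₛ L → v ∈ₛ P → v ∈ₛ L₁) → (∀ v → v ∈ₛ L → P v ≡ false → v ∈ₛ L₂) →
         (∀ w → w ∈ₛ Y₁ → Y₂ w ≡ false) → Y₁ ⊆ Y → Y₂ ⊆ Y → Matching L Y
  join {L} {L₁} {L₂} {Y} {Y₁} {Y₂} P M₁ M₂ in₁ in₂ disjoint Y₁⊆Y Y₂⊆Y = record
    { match = f ; arc = arcf ; into = intof ; injective = injf }
    where
    f : Fin n → Fin n
    f v = if P v then match M₁ v else match M₂ v

    arcf : ∀ v → v ∈ₛ L → E v (f v) ≡ true
    arcf v v∈L with P v in e
    ... | true  = arc M₁ v (in₁ v v∈L e)
    ... | false = arc M₂ v (in₂ v v∈L e)

    intof : ∀ v → v ∈ₛ L → f v ∈ₛ Y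
    intof v v∈L with P v in e
    ... | true  = Y₁⊆Y _ (into M₁ v (in₁ v v∈L e))
    ... | false = Y₂⊆Y _ (into M₂ v (in₂ v v∈L e))

    separated : ∀ u v → u ∈ₛ L₁ → v ∈ₛ L₂ → match M₁ u ≢ match M₂ v
    separated u v u∈ v∈ eq =
      true≢false (into M₂ v v∈) (subst (λ w → Y₂ w ≡ false) eq (disjoint _ (into M₁ u u∈)))

    injf : ∀ u v → u ∈ₛ L → v ∈ₛ L → f u ≡ f v → u ≡ v
    injf u v u∈L v∈L eq with P u in eu | P v in ev
    ... | true  | true  = injective M₁ u v (in₁ u u∈L eu) (in₁ v v∈L ev) eq
    ... | false | false = injective M₂ u v (in₂ u u∈L eu) (in₂ v v∈L ev) eq
    ... | true  | false = ⊥-elim (separated u v (in₁ u u∈L eu) (in₂ v v∈L ev) eq)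
    ... | false | true  = ⊥-elim (separated v u (in₁ v v∈L ev) (in₂ u u∈L eu) (sym eq))

  record Critical (L Y S : Subset n) : Set where
    field
      ⊆L       : S ⊆ L
      nonempty : 1 ≤ count S
      proper   : count S < count L
      tight    : count (N Y S) ≤ count S

  Critical-cong : ∀ {L Y S S′} → (∀ i → S i ≡ S′ i) → Critical L Y S → Critical L Y S′
  Critical-cong {L} {Y} {S} {S′} e c = record
    { ⊆L = λ i p → ⊆L i (trans (e i) p)
    ; nonempty = subst (1 ≤_) (count-cong e) nonempty
    ; proper = subst (_< count L) (count-cong e) proper
    ; tight = subst₂ _≤_ (count-cong (N-cong Y e)) (count-cong e) tight
    }
    where open Critical c

  critical? : ∀ L Y (S : Vec Bool n) → Dec (Critical L Y (lookup S))
  critical? L Y S′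
    with ⊆? S L | 1 ≤? count S | suc (count S) ≤? count L | count (N Y S) ≤? count S
    where S = lookup S′
  ... | yes a | yes b | yes c | yes d = yes (record { ⊆L = a ; nonempty = b ; proper = c ; tight = d })
  ... | no ¬a | _     | _     | _     = no (¬a ∘ Critical.⊆L)
  ... | _     | no ¬b | _     | _     = no (¬b ∘ Critical.nonempty)
  ... | _     | _     | no ¬c | _     = no (¬c ∘ Critical.proper)
  ... | _     | _     | _     | no ¬d = no (¬d ∘ Critical.tight)

  hall-restrict : ∀ {L Y S} → HallCondition L Y → S ⊆ L → HallCondition S (N Y S)
  hall-restrict {Y = Y} {S} hall S⊆L S′ S′⊆S =
    ≤-trans (hall S′ (λ i p → S⊆L i (S′⊆S i p))) (count-mono N-restrict)
    where
    N-restrict : N Y S′ ⊆ N (N Y S) S′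
    N-restrict w p with ∈-N⁻ Y S′ w p
    ... | w∈Y , v , v∈S′ , e = ∈-N (N Y S) S′ v (∈-N Y S v w∈Y (S′⊆S v v∈S′) e) v∈S′ e

  hall-complement : ∀ {L Y S} → HallCondition L Y → S ⊆ L → count (N Y S) ≤ count S →
                    HallCondition (L ─ S) (Y ─ N Y S)
  hall-complement {L} {Y} {S} hall S⊆L tight S′ S′⊆L─S =
    +-cancelʳ-≤ (count S) (count S′) (count (N Y′ S′)) (begin
      count S′ + count S           ≡⟨ sym (count-∪-disjoint S′ S (λ i p → ∧-not-elim (S′⊆L─S i p))) ⟩
      count (S′ ∪ S)               ≤⟨ hall (S′ ∪ S) S′∪S⊆L ⟩
      count (N Y (S′ ∪ S))         ≤⟨ count-mono N-split ⟩
      count (N Y′ S′ ∪ N Y S)      ≤⟨ count-∪ (N Y′ S′) (N Y S) ⟩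
      count (N Y′ S′) + count (N Y S) ≤⟨ +-monoʳ-≤ (count (N Y′ S′)) tight ⟩
      count (N Y′ S′) + count S    ∎)
    where
    open ≤-Reasoning
    Y′ = Y ─ N Y S

    S′∪S⊆L : S′ ∪ S ⊆ L
    S′∪S⊆L i p with ∨-elim p
    ... | inj₁ i∈S′ = ∧-conicalˡ _ _ (S′⊆L─S i i∈S′)
    ... | inj₂ i∈S  = S⊆L i i∈S

    N-split : N Y (S′ ∪ S) ⊆ N Y′ S′ ∪ N Y S
    N-split w p = ∨-unlessʳ outside-N
      where
      outside-N : N Y S w ≡ false → w ∈ₛ N Y′ S′
      outside-N e with ∈-N⁻ Y (S′ ∪ S) w p
      ... | w∈Y , v , v∈S′∪S , ev with ∨-elim v∈S′∪S
      ... | inj₁ v∈S′ = ∈-N Y′ S′ v (∧-not-intro w∈Y e) v∈S′ ev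
      ... | inj₂ v∈S  = ⊥-elim (true≢false (∈-N Y S v w∈Y v∈S ev) e)

  hall-remove : ∀ {L Y x} y → HallCondition L Y → (∀ S → ¬ Critical L Y S) →
                x ∈ₛ L → HallCondition (L - x) (Y - y)
  hall-remove {L} {Y} {x} y hall noCritical x∈L S S⊆L-x
    with 1 ≤? count S | suc (count S) ≤? count (N Y S)
  ... | no ¬nonempty | _ = ≤-trans (≮⇒≥ ¬nonempty) z≤n
  ... | yes nonempty | no ¬expanding = ⊥-elim (noCritical S record
    { ⊆L = λ i p → ∧-conicalˡ _ _ (S⊆L-x i p)
    ; nonempty = nonempty
    ; proper = ≤-trans (s≤s (count-mono S⊆L-x)) (≤-reflexive (sym (count-remove L x x∈L)))
    ; tight = ≤-pred (≰⇒> ¬expanding)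
    })
  ... | yes _ | yes expanding = ≤-pred (begin
    suc (count S)                 ≤⟨ expanding ⟩
    count (N Y S)                 ≤⟨ count-mono N-split ⟩
    count (⁅ y ⁆ ∪ N (Y - y) S)    ≤⟨ count-∪ ⁅ y ⁆ (N (Y - y) S) ⟩
    count ⁅ y ⁆ + count (N (Y - y) S) ≡⟨ cong (_+ count (N (Y - y) S)) (count-singleton y) ⟩
    suc (count (N (Y - y) S))      ∎)
    where
    open ≤-Reasoning
    N-split : N Y S ⊆ ⁅ y ⁆ ∪ N (Y - y) S
    N-split w p = ∨-unlessˡ λ w∉⁅y⁆ →
      let w∈Y , v , v∈S , ev = ∈-N⁻ Y S w p in ∈-N (Y - y) S v (∧-not-intro w∈Y w∉⁅y⁆) v∈S ev

  neighbour : ∀ {L Y x} → HallCondition L Y → x ∈ₛ L → ∃ λ y → y ∈ₛ Y × E x y ≡ true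
  neighbour {L} {Y} {x} hall x∈L =
    let y , y∈N = count-pos⇒∈ (N Y ⁅ x ⁆) (subst (_≤ count (N Y ⁅ x ⁆)) (count-singleton x)
                                                 (hall ⁅ x ⁆ (⁅⁆⊆ {S = L} x∈L)))
        y∈Y , v , v∈⁅x⁆ , v→y = ∈-N⁻ Y ⁅ x ⁆ y y∈N
    in y , y∈Y , subst (λ v → E v y ≡ true) (∈⁅⁆⁻ v v∈⁅x⁆) v→y

  -- Halmos–Vaughan: split along a critical set if there is one; otherwise every nonempty
  -- proper S ⊆ L has a surplus neighbour, so any single arc out of x can be kept.
  hall-bounded : ∀ m {L Y} → count L ≤ m → HallCondition L Y → Matching L Y
  hall-bounded m {L} {Y} size hall with find L
  ... | inj₂ none = empty-matching none
  hall-bounded zero    {L} {Y} size hall | inj₁ (x , x∈L) =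
    ⊥-elim (1+n≰n (≤-trans (∈⇒count-pos L x x∈L) size))
  hall-bounded (suc m) {L} {Y} size hall | inj₁ (x , x∈L) with anySubset? (critical? L Y)
  ... | yes (S′ , critical) = split-at critical
    where
    split-at : ∀ {S} → Critical L Y S → Matching L Y
    split-at {S} c = join S
      (hall-bounded m (≤-pred (≤-trans proper size)) (hall-restrict hall ⊆L))
      (hall-bounded m rest-size (hall-complement hall ⊆L tight))
      (λ _ _ v∈S → v∈S) (λ _ → ∧-not-intro) (λ _ → ∧-not-false) (N⊆ Y S) (λ w → ∧-conicalˡ _ _)
      where
      open Critical c
      rest-size : count (L ─ S) ≤ m
      rest-size = ≤-pred (begin
        suc (count (L ─ S))      ≤⟨ +-monoˡ-≤ (count (L ─ S)) nonempty ⟩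
        count S + count (L ─ S)  ≡⟨ count-⊆-split ⊆L ⟩
        count L                  ≤⟨ size ⟩
        suc m                    ∎)
        where open ≤-Reasoning
  ... | no noCritical =
    let y , y∈Y , x→y = neighbour hall x∈L
    in join ⁅ x ⁆ (singleton-matching x→y) (hall-bounded m rest-size (hall-remove y hall noCritical′ x∈L))
         (λ _ _ v∈⁅x⁆ → v∈⁅x⁆) (λ _ → ∧-not-intro) (λ _ → ∧-not-false)
         (⁅⁆⊆ {S = Y} y∈Y) (λ w → ∧-conicalˡ _ _)
    where
    noCritical′ : ∀ S → ¬ Critical L Y S
    noCritical′ S c = noCritical (tabulate S , Critical-cong (λ i → sym (lookup∘tabulate S i)) c)
    rest-size : count (L - x) ≤ m
    rest-size = ≤-pred (subst (_≤ suc m) (count-remove L x x∈L) size)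

  hall-theorem : ∀ {L Y} → HallCondition L Y → Matching L Y
  hall-theorem = hall-bounded _ ≤-refl

module _ {P : ℕ → Set} (P? : ∀ m → Dec (P m)) where

  least-below : ∀ m → (∃ λ k → P k × (∀ j → j < k → ¬ P j)) ⊎ (∀ j → j < m → ¬ P j)
  least-below zero = inj₂ λ _ ()
  least-below (suc m) with least-below m
  ... | inj₁ found = inj₁ found
  ... | inj₂ none with P? m
  ...   | yes pm = inj₁ (m , pm , none)
  ...   | no ¬pm = inj₂ λ j j<1+m → [ none j , (λ { refl → ¬pm }) ]′ (m<1+n⇒m<n∨m≡n j<1+m)

  least : ∀ {m} → P m → ∃ λ k → P k × (∀ j → j < k → ¬ P j)
  least {m} pm with least-below (suc m)
  ... | inj₁ found = found
  ... | inj₂ none  = ⊥-elim (none m ≤-refl pm)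

module Orbits {n : ℕ} (D : Digraph n) (σ : Fin n → Fin n)
              (arc : ∀ v → Arc D v (σ v)) (σ-injective : ∀ u v → σ u ≡ σ v → u ≡ v) where

  σ^ : ℕ → Fin n → Fin n
  σ^ zero    v = v
  σ^ (suc i) v = σ (σ^ i v)

  σ^-σ : ∀ i v → σ^ i (σ v) ≡ σ (σ^ i v)
  σ^-σ zero    v = refl
  σ^-σ (suc i) v = cong σ (σ^-σ i v)

  σ^-+ : ∀ i j v → σ^ (i + j) v ≡ σ^ i (σ^ j v)
  σ^-+ zero    j v = refl
  σ^-+ (suc i) j v = cong σ (σ^-+ i j v)

  σ^-injective : ∀ i {u v} → σ^ i u ≡ σ^ i v → u ≡ v
  σ^-injective zero    e = e
  σ^-injective (suc i) e = σ^-injective i (σ-injective _ _ e)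

  Returns : Fin n → ℕ → Set
  Returns v j = 1 ≤ j × σ^ j v ≡ v

  repeat⇒returns : ∀ {i j} v → i < j → σ^ i v ≡ σ^ j v → Returns v (j ∸ i)
  repeat⇒returns {i} {j} v i<j eq = m<n⇒0<n∸m i<j , σ^-injective i (begin
    σ^ i (σ^ (j ∸ i) v)  ≡⟨ sym (σ^-+ i (j ∸ i) v) ⟩
    σ^ (i + (j ∸ i)) v   ≡⟨ cong (λ k → σ^ k v) (m+[n∸m]≡n (<⇒≤ i<j)) ⟩
    σ^ j v               ≡⟨ sym eq ⟩
    σ^ i v               ∎)
    where open ≡-Reasoning

  returns : ∀ v → ∃ (Returns v)
  returns v with pigeonhole (n<1+n n) (λ (i : Fin (suc n)) → σ^ (toℕ i) v)
  ... | i , j , i<j , eq = _ , repeat⇒returns v i<j eq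

  period-spec : ∀ v → ∃ λ p → Returns v p × (∀ j → j < p → ¬ Returns v j)
  period-spec v = least (λ j → (1 ≤? j) ×-dec (σ^ j v ≟ᶠ v)) (proj₂ (returns v))

  period : Fin n → ℕ
  period v = proj₁ (period-spec v)

  period-returns : ∀ v → Returns v (period v)
  period-returns v = proj₁ (proj₂ (period-spec v))

  period-minimal : ∀ v j → j < period v → ¬ Returns v j
  period-minimal v = proj₂ (proj₂ (period-spec v))

  2≤period : ∀ v → 2 ≤ period v
  2≤period v with period v | period-returns v
  ... | suc (suc _) | _        = s≤s (s≤s z≤n)
  ... | suc zero    | _ , σv≡v = ⊥-elim (true≢false (subst (Arc D v) σv≡v (arc v)) (loopless D v))

  walk : ℕ → Fin n → List (Fin n)
  walk zero    v = []
  walk (suc k) v = v ∷ walk k (σ v)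

  ∈-walk⁻ : ∀ k v {u} → u ∈ walk k v → ∃ λ i → i < k × σ^ i v ≡ u
  ∈-walk⁻ (suc k) v (here refl) = 0 , s≤s z≤n , refl
  ∈-walk⁻ (suc k) v (there p) with ∈-walk⁻ k (σ v) p
  ... | i , i<k , eq = suc i , s≤s i<k , trans (sym (σ^-σ i v)) eq

  ∈-walk⁺ : ∀ k v {i} → i < k → σ^ i v ∈ walk k v
  ∈-walk⁺ (suc k) v {zero}  _         = here refl
  ∈-walk⁺ (suc k) v {suc i} (s≤s i<k) = there (subst (_∈ walk k (σ v)) (σ^-σ i v) (∈-walk⁺ k (σ v) i<k))

  walk-unique : ∀ k v → (∀ i j → i < k → j < k → σ^ i v ≡ σ^ j v → i ≡ j) → Unique (walk k v)
  walk-unique zero    v _        = []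
  walk-unique (suc k) v distinct = All.tabulate head-fresh ∷ walk-unique k (σ v) tail-distinct
    where
    head-fresh : ∀ {u} → u ∈ walk k (σ v) → v ≢ u
    head-fresh p v≡u with ∈-walk⁻ k (σ v) p
    ... | i , i<k , eq with distinct 0 (suc i) (s≤s z≤n) (s≤s i<k) (trans v≡u (trans (sym eq) (σ^-σ i v)))
    ... | ()
    tail-distinct : ∀ i j → i < k → j < k → σ^ i (σ v) ≡ σ^ j (σ v) → i ≡ j
    tail-distinct i j i<k j<k eq =
      suc-injective (distinct (suc i) (suc j) (s≤s i<k) (s≤s j<k) (trans (sym (σ^-σ i v)) (trans eq (σ^-σ j v))))

  walk-arcs : ∀ k f v → Arc D (σ^ k v) f → ArcsAlong D f v (walk k (σ v))
  walk-arcs zero    f v last = last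
  walk-arcs (suc k) f v last = arc v , walk-arcs k f (σ v) (subst (λ w → Arc D w f) (sym (σ^-σ k v)) last)

  orbit : Fin n → List (Fin n)
  orbit v = walk (period v) v

  orbit-unique : ∀ v → Unique (orbit v)
  orbit-unique v = walk-unique (period v) v distinct
    where
    ordered : ∀ i j → i < j → j < period v → σ^ i v ≢ σ^ j v
    ordered i j i<j j<p eq =
      period-minimal v (j ∸ i) (≤-<-trans (m∸n≤m j i) j<p) (repeat⇒returns v i<j eq)
    distinct : ∀ i j → i < period v → j < period v → σ^ i v ≡ σ^ j v → i ≡ j
    distinct i j i<p j<p eq with <-cmp i j
    ... | tri< i<j _ _ = ⊥-elim (ordered i j i<j j<p eq)
    ... | tri≈ _ i≡j _ = i≡j
    ... | tri> _ _ j<i = ⊥-elim (ordered j i j<i i<p (sym eq))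

  orbit-isCycle : ∀ v → IsCycle D (orbit v)
  orbit-isCycle v = closes (period v) (2≤period v) (proj₂ (period-returns v))
    where
    closes : ∀ k → 2 ≤ k → σ^ k v ≡ v → IsCycle D (walk k v)
    closes (suc zero)    (s≤s ()) _
    closes (suc (suc k)) _ σ^k≡v =
      walk-arcs (suc k) v v (subst (Arc D (σ^ (suc k) v)) σ^k≡v (arc (σ^ (suc k) v)))

  v∈orbit : ∀ v → v ∈ orbit v
  v∈orbit v = ∈-walk⁺ (period v) v (≤-trans (s≤s z≤n) (2≤period v))

  σ-∈-orbit : ∀ v {u} → u ∈ orbit v → σ u ∈ orbit v
  σ-∈-orbit v p with ∈-walk⁻ (period v) v p
  ... | i , i<p , refl with m≤n⇒m<n∨m≡n i<p
  ... | inj₁ 1+i<p = ∈-walk⁺ (period v) v 1+i<p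
  ... | inj₂ 1+i≡p = subst (_∈ orbit v) (sym σ^1+i≡v) (v∈orbit v)
    where
    σ^1+i≡v : σ^ (suc i) v ≡ v
    σ^1+i≡v = trans (cong (λ k → σ^ k v) 1+i≡p) (proj₂ (period-returns v))

  σ^-∈-orbit : ∀ i v → σ^ i v ∈ orbit v
  σ^-∈-orbit zero    v = v∈orbit v
  σ^-∈-orbit (suc i) v = σ-∈-orbit v (σ^-∈-orbit i v)

  orbit-trans : ∀ {v u w} → u ∈ orbit v → w ∈ orbit u → w ∈ orbit v
  orbit-trans {v} {u} u∈ w∈ with ∈-walk⁻ (period v) v u∈
  ... | i , _ , refl with ∈-walk⁻ (period u) u w∈
  ... | j , _ , refl = subst (_∈ orbit v) (σ^-+ j i v) (σ^-∈-orbit (j + i) v)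

  orbit-sym : ∀ {v u} → u ∈ orbit v → v ∈ orbit u
  orbit-sym {v} u∈ with ∈-walk⁻ (period v) v u∈
  ... | i , i<p , refl = subst (_∈ orbit (σ^ i v)) returns-to-v (σ^-∈-orbit (period v ∸ i) (σ^ i v))
    where
    open ≡-Reasoning
    returns-to-v : σ^ (period v ∸ i) (σ^ i v) ≡ v
    returns-to-v = begin
      σ^ (period v ∸ i) (σ^ i v)  ≡⟨ sym (σ^-+ (period v ∸ i) i v) ⟩
      σ^ (period v ∸ i + i) v     ≡⟨ cong (λ k → σ^ k v) (m∸n+n≡m (<⇒≤ i<p)) ⟩
      σ^ (period v) v             ≡⟨ proj₂ (period-returns v) ⟩
      v                           ∎

  IsLeast : Fin n → Set
  IsLeast v = All (λ w → toℕ v ≤ toℕ w) (orbit v)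

  IsLeast? : ∀ v → Dec (IsLeast v)
  IsLeast? v = all? (λ w → toℕ v ≤? toℕ w) (orbit v)

  least-of-orbit : ∀ u → ∃ λ m → m ∈ orbit u × IsLeast m
  least-of-orbit u = m , m∈ , All.tabulate (λ w∈ → All.lookup bound (orbit-trans m∈ w∈))
    where
    m = argmin toℕ u (orbit u)
    m∈ : m ∈ orbit u
    m∈ = [ (λ m≡u → subst (_∈ orbit u) (sym m≡u) (v∈orbit u)) , (λ p → p) ]′ (argmin-sel toℕ u (orbit u))
    bound : All (λ w → toℕ m ≤ toℕ w) (orbit u)
    bound = f[argmin]≤f[xs] {f = toℕ} u (orbit u)

  same-least : ∀ {x y z} → IsLeast x → IsLeast y → z ∈ orbit x → z ∈ orbit y → x ≡ y
  same-least lx ly z∈x z∈y = toℕ-injective (≤-antisym (All.lookup lx y∈x) (All.lookup ly (orbit-sym y∈x)))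
    where y∈x = orbit-trans z∈x (orbit-sym z∈y)

  representatives : List (Fin n)
  representatives = filter IsLeast? (allFin n)

  orbits-disjoint : ∀ {xs} → Unique xs → All IsLeast xs → Unique (concat (map orbit xs))
  orbits-disjoint []            []          = []
  orbits-disjoint {x ∷ xs} (x∉ ∷ u) (lx ∷ lxs) = Unique.++⁺ (orbit-unique x) (orbits-disjoint u lxs) disjoint
    where
    disjoint : ∀ {z} → ¬ (z ∈ orbit x × z ∈ concat (map orbit xs))
    disjoint (z∈x , z∈xs) with ∈-concat⁻′ (map orbit xs) z∈xs
    ... | _ , z∈y , y∈ with ∈-map⁻ orbit y∈
    ... | y , y∈xs , refl = All.lookup x∉ y∈xs (same-least lx (All.lookup lxs y∈xs) z∈x z∈y)

  orbits-cover : ∀ u → u ∈ concat (map orbit representatives)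
  orbits-cover u with least-of-orbit u
  ... | m , m∈ , m-least =
    ∈-concat⁺′ (orbit-sym m∈) (∈-map⁺ orbit (∈-filter⁺ IsLeast? (∈-allFin m) m-least))

  cycleFactor : CycleFactor D
  cycleFactor = map orbit representatives
              , AllP.map⁺ (All.universal orbit-isCycle representatives)
              , orbits-disjoint (Unique.filter⁺ IsLeast? (Unique.allFin⁺ n)) (AllP.all-filter IsLeast? (allFin n))
              , orbits-cover

excess-bounds-contradict : ∀ {a k r} → k + r < a →
  3 * a + 1 ≤ (k + a) + (k + a) → 3 * a + 1 ≤ (a + r) + (a + r) → ⊥
excess-bounds-contradict {k = k} {r} k+r<a h₁ h₂ with m≤n⇒∃[o]m+o≡n k+r<a
... | e , refl = m+1+n≰m _ (≤-trans (≤-reflexive (identity k r e)) (+-mono-≤ h₁ h₂))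
  where
  identity : ∀ k r e → let a = suc (k + r) + e in
    ((k + a) + (k + a) + ((a + r) + (a + r))) + suc (3 + e + e) ≡ (3 * a + 1) + (3 * a + 1)
  identity = solve-∀

2≤-of-degree-sum : ∀ {a k d} → k < a → 3 * a + 1 ≤ (k + d) + (k + a) → 2 ≤ d
2≤-of-degree-sum {k = k} {d} k<a h with 2 ≤? d
... | yes 2≤d = 2≤d
... | no 2≰d with m≤n⇒∃[o]m+o≡n k<a
... | e , refl = ⊥-elim (m+1+n≰m _ (begin
  (k + 1) + (k + a) + suc (1 + e + e)  ≡⟨ identity k e ⟩
  3 * a + 1                            ≤⟨ h ⟩
  (k + d) + (k + a)                    ≤⟨ +-monoˡ-≤ (k + a) (+-monoʳ-≤ k (≤-pred (≰⇒> 2≰d))) ⟩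
  (k + 1) + (k + a)                    ∎))
  where
  open ≤-Reasoning
  a = suc k + e
  identity : ∀ k e → let a = suc k + e in (k + 1) + (k + a) + suc (1 + e + e) ≡ 3 * a + 1
  identity = solve-∀

degree-sum-too-small : ∀ {a m} → m ≤ a → 3 * a + 1 ≤ m + (a + a) → ⊥
degree-sum-too-small {a} m≤a h =
  m+1+n≰m (3 * a) (≤-trans h (≤-trans (+-monoˡ-≤ (a + a) m≤a) (≤-reflexive (identity a))))
  where
  identity : ∀ a → a + (a + a) ≡ 3 * a
  identity = solve-∀

balanced-∁ : ∀ {a} (L : Subset (a + a)) → count L ≡ a → count (∁ L) ≡ a
balanced-∁ {a} L |L|≡a = +-cancelˡ-≡ a _ _ (trans (cong (_+ count (∁ L)) (sym |L|≡a)) (count-∁ L))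

module BalancedSide (a : ℕ) (D : Digraph (a + a)) (L : Subset (a + a)) (|L|≡a : count L ≡ a)
  (arc-switches : ∀ {u v} → Arc D u v → L v ≡ not (L u))
  (out-neighbour : ∀ u → ∃ (Arc D u))
  (dominating : ∀ u v → Dominating D u v → 3 * a + 1 ≤ deg D u + deg D v) where

  open Hall (adj D)

  Y : Subset (a + a)
  Y = ∁ L

  arc-from-L : ∀ {u w} → u ∈ₛ L → Arc D u w → w ∈ₛ Y
  arc-from-L {u} u∈L e = trans (cong not (arc-switches e)) (trans (not-involutive (L u)) u∈L)

  arc-into-Y : ∀ {u w} → Arc D u w → w ∈ₛ Y → u ∈ₛ L
  arc-into-Y {u} e w∈Y = trans (sym (trans (cong not (arc-switches e)) (not-involutive (L u)))) w∈Y

  arc-from-Y : ∀ {u w} → u ∈ₛ Y → Arc D u w → w ∈ₛ L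
  arc-from-Y u∈Y e = trans (arc-switches e) u∈Y

  opposite : Fin (a + a) → Subset (a + a)
  opposite v w = L v xor L w

  count-opposite : ∀ v → count (opposite v) ≡ a
  count-opposite v with L v
  ... | true  = balanced-∁ L |L|≡a
  ... | false = |L|≡a

  outdeg≤a : ∀ v → outdeg D v ≤ a
  outdeg≤a v = subst (outdeg D v ≤_) (count-opposite v) (count-mono out-opposite)
    where
    out-opposite : ∀ w → Arc D v w → w ∈ₛ opposite v
    out-opposite w e = subst (λ b → L v xor b ≡ true) (sym (arc-switches e)) (xor-inverseʳ (L v))

  indeg≤a : ∀ v → indeg D v ≤ a
  indeg≤a v = subst (indeg D v ≤_) (count-opposite v) (count-mono in-opposite)
    where
    in-opposite : ∀ w → Arc D w v → w ∈ₛ opposite v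
    in-opposite w e = subst (λ b → b xor L w ≡ true) (sym (arc-switches e)) (xor-inverseˡ (L w))

  dominating-pair : ∀ {u v w} → u ≢ v → Arc D u w → Arc D v w → 3 * a + 1 ≤ deg D u + deg D v
  dominating-pair u≢v u→w v→w = dominating _ _ (u≢v , _ , u→w , v→w)

  K : Subset (a + a) → Subset (a + a)
  K = N Y

  Deficient : Subset (a + a) → Set
  Deficient S = count (K S) < count S

  module MinimalDeficient {S : Subset (a + a)} (S⊆L : S ⊆ L) (deficient : Deficient S)
                          (minimal : ∀ u → u ∈ₛ S → ¬ Deficient (S - u)) where

    k : ℕ
    k = count (K S)

    out-in-K : ∀ {u w} → u ∈ₛ S → Arc D u w → w ∈ₛ K S
    out-in-K {u} u∈S e = ∈-N Y S u (arc-from-L (S⊆L u u∈S) e) u∈S e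

    -- Otherwise S - u would lose the neighbour w and stay deficient.
    shared-out-neighbour : ∀ {u w} → u ∈ₛ S → Arc D u w → ∃ λ v → v ∈ₛ S × v ≢ u × Arc D v w
    shared-out-neighbour {u} {w} u∈S u→w with find (λ v → (S - u) v ∧ adj D v w)
    ... | inj₁ (v , p) = v , ∧-conicalˡ _ _ v∈S-u , ∈--⁻ {S = S} v v∈S-u , ∧-conicalʳ _ _ p
      where v∈S-u = ∧-conicalˡ _ _ p
    ... | inj₂ none = ⊥-elim (minimal u u∈S (begin-strict
      count (K (S - u))  ≤⟨ count-mono K[S-u]⊆K[S]-w ⟩
      count (K S - w)    <⟨ ≤-pred (subst₂ (λ x y → suc x ≤ y) (count-remove (K S) w (out-in-K u∈S u→w))
                                              (count-remove S u u∈S) deficient) ⟩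
      count (S - u)      ∎))
      where
      open ≤-Reasoning
      K[S-u]⊆K[S]-w : K (S - u) ⊆ K S - w
      K[S-u]⊆K[S]-w z p =
        let z∈Y , v , v∈S-u , v→z = ∈-N⁻ Y (S - u) z p
        in ∧-not-intro (∈-N Y S v z∈Y (∧-conicalˡ _ _ v∈S-u) v→z)
                       (∉⁅⁆ λ { refl → true≢false (∧-intro v∈S-u v→z) (none v) })

    outdeg-S : ∀ {u} → u ∈ₛ S → outdeg D u ≤ k
    outdeg-S {u} u∈S = count-mono {S = adj D u} {T = K S} (λ w → out-in-K u∈S)

    deg-S : ∀ {u} → u ∈ₛ S → deg D u ≤ k + a
    deg-S {u} u∈S = +-mono-≤ (outdeg-S u∈S) (indeg≤a u)

    deficiency-bound : 3 * a + 1 ≤ (k + a) + (k + a)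
    deficiency-bound =
      let u , u∈S = count-pos⇒∈ S (≤-trans (s≤s z≤n) deficient)
          w , u→w = out-neighbour u
          v , v∈S , v≢u , v→w = shared-out-neighbour u∈S u→w
      in ≤-trans (dominating-pair (v≢u ∘ sym) u→w v→w) (+-mono-≤ (deg-S u∈S) (deg-S v∈S))

    T R : Subset (a + a)
    T = Y ─ K S
    R = L ─ S

    r : ℕ
    r = count R

    k+|T|≡a : k + count T ≡ a
    k+|T|≡a = trans (count-⊆-split (N⊆ Y S)) (balanced-∁ L |L|≡a)

    k+r<a : k + r < a
    k+r<a = subst (k + r <_) (trans (count-⊆-split S⊆L) |L|≡a) (+-monoˡ-< r deficient)

    k<a : k < a
    k<a = ≤-<-trans (m≤m+n k r) k+r<a

    in-neighbour-of-T : ∀ {x y} → y ∈ₛ T → Arc D x y → x ∈ₛ R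
    in-neighbour-of-T y∈T x→y = ∧-not-intro (arc-into-Y x→y (∧-conicalˡ _ _ y∈T))
      (¬-not λ x∈S → true≢false (out-in-K x∈S x→y) (∧-not-elim y∈T))

    deg-T : ∀ {y} → y ∈ₛ T → deg D y ≤ outdeg D y + r
    deg-T {y} y∈T =
      +-monoʳ-≤ (outdeg D y) (count-mono {S = λ x → adj D x y} {T = R} (λ x → in-neighbour-of-T y∈T))

    T-no-common-out : ∀ {y₁ y₂ x} → y₁ ∈ₛ T → y₂ ∈ₛ T → Arc D y₁ x → Arc D y₂ x → y₁ ≡ y₂
    T-no-common-out {y₁} {y₂} t₁ t₂ e₁ e₂ with y₁ ≟ᶠ y₂
    ... | yes y₁≡y₂ = y₁≡y₂
    ... | no y₁≢y₂  = ⊥-elim (excess-bounds-contradict k+r<a deficiency-bound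
            (≤-trans (dominating-pair y₁≢y₂ e₁ e₂) (+-mono-≤ (deg-T≤ t₁) (deg-T≤ t₂))))
      where
      deg-T≤ : ∀ {y} → y ∈ₛ T → deg D y ≤ a + r
      deg-T≤ {y} y∈T = ≤-trans (deg-T y∈T) (+-monoˡ-≤ r (outdeg≤a y))

    φ : Fin (a + a) → Fin (a + a)
    φ y = proj₁ (out-neighbour y)

    φ-arc : ∀ y → Arc D y (φ y)
    φ-arc y = proj₂ (out-neighbour y)

    φ-injective : ∀ i j → i ∈ₛ T → j ∈ₛ T → φ i ≡ φ j → i ≡ j
    φ-injective i j i∈T j∈T e = T-no-common-out i∈T j∈T (subst (Arc D i) e (φ-arc i)) (φ-arc j)

    outdeg-T : ∀ {y} → y ∈ₛ T → outdeg D y ≤ suc k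
    outdeg-T {y} y∈T = +-cancelʳ-≤ (count (L ─ O)) (outdeg D y) (suc k) (begin
      outdeg D y + count (L ─ O)  ≡⟨ trans (count-⊆-split O⊆L) |L|≡a ⟩
      a                           ≡⟨ sym k+|T|≡a ⟩
      k + count T                 ≡⟨ cong (k +_) (count-remove T y y∈T) ⟩
      k + suc (count (T - y))     ≤⟨ +-monoʳ-≤ k (s≤s (count-injection φ into φ-injective′)) ⟩
      k + suc (count (L ─ O))     ≡⟨ +-suc k _ ⟩
      suc k + count (L ─ O)       ∎)
      where
      open ≤-Reasoning
      -- φ sends T - y injectively to the vertices of L that y does not point to.
      O : Subset (a + a)
      O = adj D y
      O⊆L : O ⊆ L
      O⊆L w = arc-from-Y (∧-conicalˡ _ _ y∈T)
      into : ∀ i → i ∈ₛ T - y → φ i ∈ₛ L ─ O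
      into i p = ∧-not-intro (arc-from-Y (∧-conicalˡ _ _ i∈T) (φ-arc i))
        (¬-not λ y→φi → ∈--⁻ {S = T} i p (T-no-common-out i∈T y∈T (φ-arc i) y→φi))
        where i∈T = ∧-conicalˡ _ _ p
      φ-injective′ : ∀ i j → i ∈ₛ T - y → j ∈ₛ T - y → φ i ≡ φ j → i ≡ j
      φ-injective′ i j p q = φ-injective i j (∧-conicalˡ _ _ p) (∧-conicalˡ _ _ q)

    second-in-neighbour : ∀ {x y} → x ∈ₛ S → Arc D y x → ∃ λ z → z ≢ y × Arc D z x
    second-in-neighbour {x} {y} x∈S y→x =
      let w , x→w = out-neighbour x
          v , v∈S , v≢x , v→w = shared-out-neighbour x∈S x→w
          2≤indeg = 2≤-of-degree-sum k<a (≤-trans (dominating-pair (v≢x ∘ sym) x→w v→w)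
                      (+-mono-≤ (+-monoˡ-≤ (indeg D x) (outdeg-S x∈S)) (deg-S v∈S)))
          z , p = count-pos⇒∈ (In - y) (≤-pred (subst (2 ≤_) (count-remove In y y→x) 2≤indeg))
      in z , ∈--⁻ {S = In} z p , ∧-conicalˡ _ _ p
      where
      In : Subset (a + a)
      In z = adj D z x

    φ-leaves-S : ∀ {y} → y ∈ₛ T → φ y ∈ₛ S → ⊥
    φ-leaves-S {y} y∈T φy∈S =
      let z , z≢y , z→φy = second-in-neighbour φy∈S (φ-arc y)
      in degree-sum-too-small (≤-trans (+-monoˡ-≤ r (outdeg-T y∈T)) k+r<a)
           (≤-trans (dominating-pair (z≢y ∘ sym) (φ-arc y) z→φy)
                    (+-mono-≤ (deg-T y∈T) (+-mono-≤ (outdeg≤a z) (indeg≤a z))))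

    absurd : ⊥
    absurd with find (λ y → T y ∧ S (φ y))
    ... | inj₁ (y , p) = φ-leaves-S (∧-conicalˡ _ _ p) (∧-conicalʳ _ _ p)
    ... | inj₂ none = <-irrefl refl (begin-strict
      a            ≡⟨ sym k+|T|≡a ⟩
      k + count T  ≤⟨ +-monoʳ-≤ k (count-injection φ into-R φ-injective) ⟩
      k + r        <⟨ k+r<a ⟩
      a            ∎)
      where
      open ≤-Reasoning
      into-R : ∀ y → y ∈ₛ T → φ y ∈ₛ R
      into-R y y∈T = ∧-not-intro (arc-from-Y (∧-conicalˡ _ _ y∈T) (φ-arc y))
                                 (subst (λ t → t ∧ S (φ y) ≡ false) y∈T (none y))

  Deficient? : ∀ S → Dec (Deficient S)
  Deficient? S = count (K S) <? count S

  no-deficient-subset : ∀ m S → count S ≤ m → S ⊆ L → ¬ Deficient S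
  no-deficient-subset zero    S size S⊆L deficient = 1+n≰n (≤-trans (≤-trans (s≤s z≤n) deficient) size)
  no-deficient-subset (suc m) S size S⊆L deficient
    with any? (λ u → (S u ≟ᵇ true) ×-dec Deficient? (S - u))
  ... | no ¬shrinkable = MinimalDeficient.absurd S⊆L deficient λ u u∈S d → ¬shrinkable (u , u∈S , d)
  ... | yes (u , u∈S , d) = no-deficient-subset m (S - u)
          (≤-pred (subst (_≤ suc m) (count-remove S u u∈S) size)) (λ i p → S⊆L i (∧-conicalˡ _ _ p)) d

  matching : Matching L Y
  matching = hall-theorem λ S S⊆L → ≮⇒≥ (no-deficient-subset _ S ≤-refl S⊆L)

another-vertex : ∀ {n} → 2 ≤ n → (u : Fin n) → ∃ λ v → u ≢ v
another-vertex (s≤s (s≤s _)) zero    = suc zero , λ ()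
another-vertex (s≤s (s≤s _)) (suc u) = zero , λ ()

first-arc : ∀ {n} {D : Digraph n} {u v} → Reach D u v → u ≢ v → ∃ (Arc D u)
first-arc here u≢u = ⊥-elim (u≢u refl)
first-arc {u = u} (step {v} r v→w) _ with u ≟ᶠ v
... | yes refl = _ , v→w
... | no u≢v   = first-arc r u≢v

lemma3p3 : (a : ℕ) → 2 ≤ a → (D : Digraph (a + a)) →
    StronglyConnected D → BalancedBipartite a D →
    (∀ u v → Dominating D u v → 3 * a + 1 ≤ deg D u + deg D v) →
    CycleFactor D
lemma3p3 a 2≤a D strong (part , |part|≡a , crossing) dominating =
  Orbits.cycleFactor D (match M) (λ v → arc M v refl) (λ u v → injective M u v refl refl)
  where
  open Hall (adj D)
  open Matching

  out-neighbour : ∀ u → ∃ (Arc D u)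
  out-neighbour u = let v , u≢v = another-vertex (≤-trans 2≤a (m≤m+n a a)) u in first-arc (strong u v) u≢v

  switches : ∀ {u v} → Arc D u v → part v ≡ not (part u)
  switches e = ¬-not (≢-sym (crossing _ _ e))

  M : Matching (λ _ → true) (λ _ → true)
  M = join part
    (BalancedSide.matching a D part |part|≡a switches out-neighbour dominating)
    (BalancedSide.matching a D (∁ part) (balanced-∁ part |part|≡a) (cong not ∘ switches) out-neighbour dominating)
    (λ _ _ v∈part → v∈part) (λ _ _ → not-true) (λ _ → cong not) (λ _ _ → refl) (λ _ _ → refl)
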